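{- Let $\langle W,R,S,\Vdash\rangle$ be a Visser model. Let $v$ be a valuation on the bitopological space $\langle W,\tau_R,\tau_S\rangle$ such that $v(p)=\{x\in W: x\Vdash p\}$ for every propositional variable $p$. Then $v(\varphi)=\{x\in W: x\Vdash\varphi\}$ for every $\mathcal{L}(\Box,\rhd)$-formula $\varphi$.
   Context: $\mathcal{L}(\Box,\rhd)$ has propositional variables, $\top,\bot$, $\neg,\land,\lor,\to$, unary $\Box,\Diamond$ and binary $\rhd$. A Visser frame is $\langle W,R,S\rangle$ with $W\ne\varnothing$, $R$ a transitive and conversely well-founded binary relation on $W$ (no infinite sequence $x_0Rx_1Rx_2\cdots$), and $S$ a transitive reflexive binary relation on $W$. A Visser model $\langle W,R,S,\Vdash\rangle$ adds a relation $\Vdash$ between points and formulas satisfying the usual Boolean clauses ($x\nVdash\bot$, $x\Vdash\top$, etc.), $x\Vdash\Box\varphi$ iff $\forall y(xRy\Rightarrow y\Vdash\varphi)$, $x\Vdash\Diamond\varphi$ iff $\exists y(xRy \wedge y\Vdash\varphi)$, and $x\Vdash\varphi\rhd\psi$ iff for all $y$ with $xRy$ and $y\Vdash\varphi$ there is $z$ with $xRz$, $ySz$ and $z\Vdash\psi$. For a binary relation $P$ on $W$, $\tau_P$ is the family of $P$-upward closed subsets $Y$ (i.e., $x\in Y$ and $xPy$ imply $y\in Y$). For a topology $\tau$ on $X$, $d_\tau(Y)=\{x: \text{every } U\in\tau \text{ containing } x \text{ meets } Y\setminus\{x\}\}$, $cd_\tau(Y)=X\setminus d_\tau(X\setminus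 Y)$. For a bitopological space $\langle X,\tau^0,\tau^1\rangle$, $e_{\tau^0,\tau^1}(Y,Z)=\{x:\forall U\in\tau^1[x\in d_{\tau^0}(Y\cap U)\Rightarrow x\in d_{\tau^0}(Z\cap U)]\}$, and a valuation $v$ maps formulas to subsets of $X$, Boolean on connectives ($v(\bot)=\varnothing$, $v(\top)=X$, complement, intersection, union, $\overline{v(\varphi)}\cup v(\psi)$), with $v(\Box\varphi)=cd_{\tau^0}(v(\varphi))$, $v(\Diamond\varphi)=d_{\tau^0}(v(\varphi))$, $v(\varphi\rhd\psi)=e_{\tau^0,\tau^1}(v(\varphi),v(\psi))$. -}

module Defs where

open import Level using (Level; 0ℓ; Lift) renaming (suc to lsuc)
open import Data.Nat using (ℕ; suc)
open import Data.Empty using (⊥)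
open import Data.Unit using (⊤)
open import Data.Product using (Σ; ∃; _×_)
open import Data.Sum using (_⊎_)
open import Relation.Nullary using (¬_)
open import Relation.Binary.PropositionalEquality using (_≡_; _≢_)
open import Function.Bundles using (_⇔_)

data Fm : Set where
  var  : ℕ → Fm
  `⊤ `⊥ : Fm
  `¬_  : Fm → Fm
  _`∧_ _`∨_ _`→_ : Fm → Fm → Fm
  `□_ `◇_ : Fm → Fm
  _`▷_ : Fm → Fm → Fm

record VisserFrame : Set₁ where
  field
    W : Set
    inhabited : W
    R S : W → W → Set
    R-trans : ∀ {x y z} → R x y → R y z → R x z
    R-cwf : ¬ (Σ (ℕ → W) λ f → ∀ n → R (f n) (f (suc n)))
    S-refl : ∀ {x} → S x x
    S-trans : ∀ {x y z} → S x y → S y z → S x z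

record VisserModel : Set₁ where
  field
    frame : VisserFrame
  open VisserFrame frame public
  field
    _⊩_ : W → Fm → Set
    ⊩⊥ : ∀ x → ¬ (x ⊩ `⊥)
    ⊩⊤ : ∀ x → x ⊩ `⊤
    ⊩¬ : ∀ x φ → (x ⊩ (`¬ φ)) ⇔ (¬ (x ⊩ φ))
    ⊩∧ : ∀ x φ ψ → (x ⊩ (φ `∧ ψ)) ⇔ ((x ⊩ φ) × (x ⊩ ψ))
    ⊩∨ : ∀ x φ ψ → (x ⊩ (φ `∨ ψ)) ⇔ ((x ⊩ φ) ⊎ (x ⊩ ψ))
    ⊩→ : ∀ x φ ψ → (x ⊩ (φ `→ ψ)) ⇔ ((x ⊩ φ) → (x ⊩ ψ))
    ⊩□ : ∀ x φ → (x ⊩ (`□ φ)) ⇔ (∀ y → R x y → y ⊩ φ)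
    ⊩◇ : ∀ x φ → (x ⊩ (`◇ φ)) ⇔ (∃ λ y → R x y × (y ⊩ φ))
    ⊩▷ : ∀ x φ ψ → (x ⊩ (φ `▷ ψ)) ⇔
           (∀ y → R x y → y ⊩ φ → ∃ λ z → R x z × S y z × (z ⊩ ψ))

-- Subsets of W (opens) are predicates W → Set; a "family of subsets"
-- (e.g. a topology) is a predicate on such subsets.
module _ {W : Set} where

  Family : Set₁
  Family = (W → Set) → Set

  τ[_] : (W → W → Set) → Family
  τ[ P ] U = ∀ x y → U x → P x y → U y

  -- derived set operator; values of valuations live in W → Set₁
  d : Family → (W → Set₁) → (W → Set₁)
  d τ Y x = ∀ U → τ U → U x → ∃ λ y → U y × Y y × (y ≢ x)

  cd : Family → (W → Set₁) → (W → Set₁)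
  cd τ Y x = ¬ d τ (λ z → ¬ Y z) x

  _∩_ : (W → Set₁) → (W → Set) → (W → Set₁)
  (Y ∩ U) x = Y x × Lift (lsuc 0ℓ) (U x)

  e : Family → Family → (W → Set₁) → (W → Set₁) → (W → Set₁)
  e τ₀ τ₁ Y Z x = ∀ U → τ₁ U → d τ₀ (Y ∩ U) x → d τ₀ (Z ∩ U) x

  -- v is a valuation on the bitopological space ⟨W, τ₀, τ₁⟩
  -- (equalities of subsets read extensionally, pointwise ⇔)
  record IsValuation (τ₀ τ₁ : Family) (v : Fm → W → Set₁) : Set₁ where
    field
      v⊥ : ∀ x → ¬ v `⊥ x
      v⊤ : ∀ x → v `⊤ x
      v¬ : ∀ φ x → v (`¬ φ) x ⇔ (¬ v φ x)
      v∧ : ∀ φ ψ x → v (φ `∧ ψ) x ⇔ (v φ x × v ψ x)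
      v∨ : ∀ φ ψ x → v (φ `∨ ψ) x ⇔ (v φ x ⊎ v ψ x)
      v→ : ∀ φ ψ x → v (φ `→ ψ) x ⇔ ((¬ v φ x) ⊎ v ψ x)
      v□ : ∀ φ x → v (`□ φ) x ⇔ cd τ₀ (v φ) x
      v◇ : ∀ φ x → v (`◇ φ) x ⇔ d τ₀ (v φ) x
      v▷ : ∀ φ ψ x → v (φ `▷ ψ) x ⇔ e τ₀ τ₁ (v φ) (v ψ) x

{-# OPTIONS --safe #-}
-- In the topology of R-upsets the smallest neighbourhood of x is {x} ∪ R[x],
-- and R is irreflexive (being conversely well-founded), so x lies in the
-- derived set of Y iff some R-successor of x lies in Y.  Hence d, cd and e
-- compute ◇, □ and ▷ (for ▷, test e against the S-upset S[y] of an
-- R-successor y); induction on φ does the rest, with excluded middle bridging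
-- the classical clauses for → and □.
module Submission where

open import Defs
open import Level using (Lift; lift; lower) renaming (suc to lsuc; zero to lzero)
open import Data.Nat using (ℕ; suc)
open import Function.Bundles using (_⇔_; mk⇔; Equivalence)
open import Axiom.ExcludedMiddle using (ExcludedMiddle)
open import Data.Product using (Σ; ∃; _×_; _,_)
open import Data.Sum using (_⊎_; inj₁; inj₂)
open import Data.Empty using (⊥-elim)
open import Relation.Nullary using (¬_; yes; no)
open import Relation.Binary.PropositionalEquality using (_≡_; refl)
open import Function.Construct.Identity using (⇔-id)

open Equivalence

-- A Set₁-valued proposition agreeing with a Set-valued one; valuations take
-- values in W → Set₁ while forcing takes values in W → Set.
infix 4 _⇔↑_
_⇔↑_ : Set₁ → Set → Set₁
A ⇔↑ B = A ⇔ Lift (lsuc lzero) B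

infix 4 _≐_
_≐_ : {W : Set} → (W → Set₁) → (W → Set) → Set₁
Y ≐ P = ∀ x → Y x ⇔↑ P x

⇔↑-sandwich : {A A′ : Set₁} {B B′ : Set} → A ⇔ A′ → A′ ⇔↑ B′ → B ⇔ B′ → A ⇔↑ B
⇔↑-sandwich A⇔A′ A′⇔B′ B⇔B′ = mk⇔
  (λ a → lift (from B⇔B′ (lower (to A′⇔B′ (to A⇔A′ a)))))
  (λ b → from A⇔A′ (from A′⇔B′ (lift (to B⇔B′ (lower b)))))

⇔↑-true : {A : Set₁} {B : Set} → A → B → A ⇔↑ B
⇔↑-true a b = mk⇔ (λ _ → lift b) (λ _ → a)

⇔↑-false : {A : Set₁} {B : Set} → ¬ A → ¬ B → A ⇔↑ B
⇔↑-false ¬a ¬b = mk⇔ (λ a → ⊥-elim (¬a a)) (λ b → ⊥-elim (¬b (lower b)))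

module _ {A C : Set₁} {B D : Set} (A⇔B : A ⇔↑ B) (C⇔D : C ⇔↑ D) where

  ×-⇔↑ : (A × C) ⇔↑ (B × D)
  ×-⇔↑ = mk⇔
    (λ (a , c) → lift (lower (to A⇔B a) , lower (to C⇔D c)))
    (λ (lift (b , d)) → from A⇔B (lift b) , from C⇔D (lift d))

  ⊎-⇔↑ : (A ⊎ C) ⇔↑ (B ⊎ D)
  ⊎-⇔↑ = mk⇔
    (λ { (inj₁ a) → lift (inj₁ (lower (to A⇔B a)))
       ; (inj₂ c) → lift (inj₂ (lower (to C⇔D c))) })
    (λ { (lift (inj₁ b)) → inj₁ (from A⇔B (lift b))
       ; (lift (inj₂ d)) → inj₂ (from C⇔D (lift d)) })

  ¬⊎-⇔↑-→ : ExcludedMiddle (lsuc lzero) → (¬ A ⊎ C) ⇔↑ (B → D)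
  ¬⊎-⇔↑-→ lem = mk⇔
    (λ { (inj₁ ¬a) → lift (λ b → ⊥-elim (¬a (from A⇔B (lift b))))
       ; (inj₂ c) → lift (λ _ → lower (to C⇔D c)) })
    implication
    where
    implication : Lift (lsuc lzero) (B → D) → ¬ A ⊎ C
    implication (lift f) with lem {A}
    ... | yes a = inj₂ (from C⇔D (lift (f (lower (to A⇔B a)))))
    ... | no ¬a = inj₁ ¬a

¬-⇔↑ : {A : Set₁} {B : Set} → A ⇔↑ B → (¬ A) ⇔↑ (¬ B)
¬-⇔↑ A⇔B = mk⇔
  (λ ¬a → lift (λ b → ¬a (from A⇔B (lift b))))
  (λ ¬b a → lower ¬b (lower (to A⇔B a)))

cwf⇒irreflexive : {W : Set} {R : W → W → Set} →
  ¬ (Σ (ℕ → W) λ f → ∀ n → R (f n) (f (suc n))) → ∀ {x} → ¬ R x x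
cwf⇒irreflexive cwf {x} xRx = cwf ((λ _ → x) , (λ _ → xRx))

module UpsetTopology {W : Set} (R : W → W → Set)
  (R-trans : ∀ {x y z} → R x y → R y z → R x z)
  (R-irrefl : ∀ {x} → ¬ R x x) where

  cone : W → W → Set
  cone x z = x ≡ z ⊎ R x z

  cone-isUpset : ∀ x → τ[ R ] (cone x)
  cone-isUpset x _ _ (inj₁ refl) r = inj₂ r
  cone-isUpset x _ _ (inj₂ r′) r = inj₂ (R-trans r′ r)

  d-⇔↑-successor : {Y : W → Set₁} {P : W → Set} → Y ≐ P →
    d τ[ R ] Y ≐ λ x → ∃ λ y → R x y × P y
  d-⇔↑-successor {Y} {P} Y≐P x = mk⇔ successor neighbourhood
    where
    successor : d τ[ R ] Y x → Lift (lsuc lzero) (∃ λ y → R x y × P y)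
    successor dY with dY (cone x) (cone-isUpset x) (inj₁ refl)
    ... | _ , inj₁ refl , _ , y≢x = ⊥-elim (y≢x refl)
    ... | y , inj₂ xRy , Yy , _ = lift (y , xRy , lower (to (Y≐P y) Yy))
    neighbourhood : Lift (lsuc lzero) (∃ λ y → R x y × P y) → d τ[ R ] Y x
    neighbourhood (lift (y , xRy , Py)) U U-upset Ux =
      y , U-upset x y Ux xRy , from (Y≐P y) (lift Py) , λ { refl → R-irrefl xRy }

  cd-⇔↑-allSuccessors : ExcludedMiddle (lsuc lzero) →
    {Y : W → Set₁} {P : W → Set} → Y ≐ P →
    cd τ[ R ] Y ≐ λ x → ∀ y → R x y → P y
  cd-⇔↑-allSuccessors lem {Y} {P} Y≐P x = mk⇔
    (λ cdY → lift λ y xRy → stable y λ ¬Py →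
      cdY (from (d-complement x) (lift (y , xRy , ¬Py))))
    (λ □P d¬Y → let (y , xRy , ¬Py) = lower (to (d-complement x) d¬Y) in
      ¬Py (lower □P y xRy))
    where
    d-complement : d τ[ R ] (λ z → ¬ Y z) ≐ λ x → ∃ λ y → R x y × ¬ P y
    d-complement = d-⇔↑-successor (λ y → ¬-⇔↑ (Y≐P y))
    stable : ∀ y → ¬ ¬ P y → P y
    stable y ¬¬Py with lem {Lift (lsuc lzero) (P y)}
    ... | yes Py = lower Py
    ... | no ¬Py = ⊥-elim (¬¬Py (λ Py → ¬Py (lift Py)))

  module _ (S : W → W → Set)
    (S-refl : ∀ {x} → S x x)
    (S-trans : ∀ {x y z} → S x y → S y z → S x z) where

    e-⇔↑-interpretability : {Y Z : W → Set₁} {P Q : W → Set} → Y ≐ P → Z ≐ Q →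
      e τ[ R ] τ[ S ] Y Z ≐ λ x → ∀ y → R x y → P y → ∃ λ z → R x z × S y z × Q z
    e-⇔↑-interpretability {Y} {Z} Y≐P Z≐Q x = mk⇔
      (λ eYZ → lift λ y xRy Py →
        let dZ = eYZ (S y) (λ _ _ → S-trans)
                     (from (d∩ Y≐P (S y) x) (lift (y , xRy , Py , S-refl)))
            (z , xRz , Qz , Syz) = lower (to (d∩ Z≐Q (S y) x) dZ)
        in z , xRz , Syz , Qz)
      (λ ▷PQ U U-upset dY →
        let (y , xRy , Py , Uy) = lower (to (d∩ Y≐P U x) dY)
            (z , xRz , Syz , Qz) = lower ▷PQ y xRy Py
        in from (d∩ Z≐Q U x) (lift (z , xRz , Qz , U-upset y z Uy Syz)))
      where
      d∩ : {X : W → Set₁} {T : W → Set} → X ≐ T → ∀ U →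
        d τ[ R ] (X ∩ U) ≐ λ x → ∃ λ y → R x y × T y × U y
      d∩ X≐T U = d-⇔↑-successor (λ y → ×-⇔↑ (X≐T y) (⇔-id _))

proposition3p6 : ExcludedMiddle (lsuc lzero) →
    (M : VisserModel) → let open VisserModel M in
    (v : Fm → W → Set₁) → IsValuation τ[ R ] τ[ S ] v →
    (∀ (p : ℕ) x → v (var p) x ⇔ Lift (lsuc lzero) (x ⊩ var p)) →
    ∀ (φ : Fm) x → v φ x ⇔ Lift (lsuc lzero) (x ⊩ φ)
proposition3p6 lem M v V v-var = truth-set
  where
  open VisserModel M
  open IsValuation V
  open UpsetTopology R R-trans (cwf⇒irreflexive {R = R} R-cwf)

  truth-set : ∀ φ → v φ ≐ (_⊩ φ)
  truth-set (var p) = v-var p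
  truth-set `⊤ x = ⇔↑-true (v⊤ x) (⊩⊤ x)
  truth-set `⊥ x = ⇔↑-false (v⊥ x) (⊩⊥ x)
  truth-set (`¬ φ) x = ⇔↑-sandwich (v¬ φ x) (¬-⇔↑ (truth-set φ x)) (⊩¬ x φ)
  truth-set (φ `∧ ψ) x =
    ⇔↑-sandwich (v∧ φ ψ x) (×-⇔↑ (truth-set φ x) (truth-set ψ x)) (⊩∧ x φ ψ)
  truth-set (φ `∨ ψ) x =
    ⇔↑-sandwich (v∨ φ ψ x) (⊎-⇔↑ (truth-set φ x) (truth-set ψ x)) (⊩∨ x φ ψ)
  truth-set (φ `→ ψ) x =
    ⇔↑-sandwich (v→ φ ψ x) (¬⊎-⇔↑-→ (truth-set φ x) (truth-set ψ x) lem) (⊩→ x φ ψ)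
  truth-set (`□ φ) x =
    ⇔↑-sandwich (v□ φ x) (cd-⇔↑-allSuccessors lem (truth-set φ) x) (⊩□ x φ)
  truth-set (`◇ φ) x =
    ⇔↑-sandwich (v◇ φ x) (d-⇔↑-successor (truth-set φ) x) (⊩◇ x φ)
  truth-set (φ `▷ ψ) x =
    ⇔↑-sandwich (v▷ φ ψ x)
      (e-⇔↑-interpretability S S-refl S-trans (truth-set φ) (truth-set ψ) x) (⊩▷ x φ ψ)
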